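{- Let $(X,\Sigma)$ be an implicational base with closure operator $\phi$, let $\mathcal{B}^+$ be an antichain of $\mathcal{L}(\Sigma)$, let $\mathcal{B}^-$ be the dual antichain of $\mathcal{B}^+$ in $\mathcal{L}(\Sigma)$, and let $\mathcal{H}=\{X\setminus B\mid B\in\mathcal{B}^+\}$. Let $I\in\mathcal{B}^-$ and let $T$ be a minimal transversal of $\mathcal{H}$ such that $I\subseteq\phi(T)$. Then $T$ is a minimal covering set of $I$.
   Context: An implicational base $(X,\Sigma)$ is a finite set $X$ with a finite set $\Sigma$ of implications $A\rightarrow b$, $A\subseteq X$, $b\in X$. A set $C\subseteq X$ is closed if for every $A\rightarrow b\in\Sigma$, $b\in C$ or $A\not\subseteq C$; $\phi(C)$ is the smallest closed set containing $C$. $\mathcal{L}(\Sigma)$ is the lattice of closed sets ordered by inclusion; an antichain is a family of pairwise inclusion-incomparable closed sets. Antichains $\mathcal{B}^+,\mathcal{B}^-$ are dual in $\mathcal{L}(\Sigma)$ if every closed set is contained in a member of $\mathcal{B}^+$ or contains a member of $\mathcal{B}^-$, but not both. A set $T\subseteq X$ is a covering set of $I\subseteq X$ if $I\subseteq\phi(T)$; it is a minimal covering set if moreover $I\not\subseteq\phi(T\setminus\{x\})$ for every $x\in T$. A transversal of $\mathcal{H}$ is a set meeting every hyperedge; minimal means inclusion-minimal. -}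

module Defs where

open import Data.Nat using (ℕ)
open import Data.Fin using (Fin)
open import Data.Fin.Subset using (Subset; _∈_; _⊆_; _⊂_; _-_; ∁)
open import Data.List using (List; map)
open import Data.List.Relation.Unary.All using (All)
open import Data.List.Membership.Propositional renaming (_∈_ to _∈ᴸ_)
open import Data.Product using (_×_; ∃; Σ-syntax)
open import Data.Sum using (_⊎_)
open import Relation.Nullary using (¬_)
open import Relation.Binary.PropositionalEquality using (_≡_)

record Implication (n : ℕ) : Set where
  constructor _⇒_
  field
    premise    : Subset n
    conclusion : Fin n

Base : ℕ → Set
Base n = List (Implication n)

Closed : ∀ {n} → Base n → Subset n → Set
Closed Σ' C = All (λ i → Implication.conclusion i ∈ C ⊎ ¬ (Implication.premise i ⊆ C)) Σ'

-- x ∈ φ(C): φ(C) is the smallest closed set containing C,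
-- i.e. the intersection of all closed supersets of C.
_∈φ_ : ∀ {n} {Σ' : Base n} → Fin n → Subset n → Set
_∈φ_ {n} {Σ'} x C = ∀ (D : Subset n) → Closed Σ' D → C ⊆ D → x ∈ D

CoveringSet : ∀ {n} → Base n → Subset n → Subset n → Set
CoveringSet Σ' I T = ∀ {x} → x ∈ I → _∈φ_ {Σ' = Σ'} x T

MinimalCoveringSet : ∀ {n} → Base n → Subset n → Subset n → Set
MinimalCoveringSet Σ' I T =
  CoveringSet Σ' I T × (∀ {x} → x ∈ T → ¬ CoveringSet Σ' I (T - x))

Family : ℕ → Set
Family n = List (Subset n)

Antichain : ∀ {n} → Base n → Family n → Set
Antichain Σ' 𝓑 =
  All (Closed Σ') 𝓑 × (∀ {A B} → A ∈ᴸ 𝓑 → B ∈ᴸ 𝓑 → A ⊆ B → A ≡ B)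

Dual : ∀ {n} → Base n → Family n → Family n → Set
Dual Σ' 𝓑⁺ 𝓑⁻ = ∀ C → Closed Σ' C →
  ((∃ λ B → B ∈ᴸ 𝓑⁺ × C ⊆ B) × ¬ (∃ λ B → B ∈ᴸ 𝓑⁻ × B ⊆ C))
  ⊎ (¬ (∃ λ B → B ∈ᴸ 𝓑⁺ × C ⊆ B) × (∃ λ B → B ∈ᴸ 𝓑⁻ × B ⊆ C))

Transversal : ∀ {n} → Family n → Subset n → Set
Transversal 𝓗 T = ∀ {E} → E ∈ᴸ 𝓗 → ∃ λ x → x ∈ T × x ∈ E

MinimalTransversal : ∀ {n} → Family n → Subset n → Set
MinimalTransversal 𝓗 T =
  Transversal 𝓗 T × (∀ T' → T' ⊂ T → ¬ Transversal 𝓗 T')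

complements : ∀ {n} → Family n → Family n
complements = map ∁

-- A covering set T' of I ∈ 𝓑⁻ meets the complement of every B ∈ 𝓑⁺: otherwise
-- T' ⊆ B, and as B is closed, I ⊆ φ(T') ⊆ B, so the closed set B would both lie
-- in a member of 𝓑⁺ and contain a member of 𝓑⁻, against duality. Hence T ∖ {x}
-- cannot cover I, since by minimality of T it is not a transversal of 𝓗.
module Submission where

open import Defs
open import Data.Nat using (ℕ)
open import Data.Fin.Subset using (Subset; _∈_; _⊆_; ∁; _-_)
open import Data.Fin.Subset.Properties using (_∈?_; ⊆-refl; x∉p⇒x∈∁p; x∈p⇒p-x⊂p)
open import Data.Fin.Properties using (any?)
open import Data.List.Membership.Propositional renaming (_∈_ to _∈ᴸ_)
open import Data.List.Membership.Propositional.Properties using (∈-map⁻)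
open import Data.List.Relation.Unary.All using (lookup)
open import Data.Product using (∃; _×_; _,_)
open import Data.Sum using (inj₁; inj₂)
open import Data.Empty using (⊥-elim)
open import Function using (_$_)
open import Relation.Nullary using (¬_; yes; no; contradiction)
open import Relation.Nullary.Decidable using (_×-dec_)
open import Relation.Binary.PropositionalEquality using (refl)

private
  variable
    n : ℕ

misses-∁⇒⊆ : {T B : Subset n} → ¬ (∃ λ y → y ∈ T × y ∈ ∁ B) → T ⊆ B
misses-∁⇒⊆ {B = B} misses {y} y∈T with y ∈? B
... | yes y∈B = y∈B
... | no  y∉B = contradiction (y , y∈T , x∉p⇒x∈∁p y∉B) misses

covering⇒⊆-closed : (Σ' : Base n) {I T D : Subset n} →
  CoveringSet Σ' I T → Closed Σ' D → T ⊆ D → I ⊆ D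
covering⇒⊆-closed Σ' {D = D} cov D-closed T⊆D x∈I = cov x∈I D D-closed T⊆D

dual⇒member⁺-contains-no-member⁻ : (Σ' : Base n) {𝓑⁺ 𝓑⁻ : Family n} →
  Dual Σ' 𝓑⁺ 𝓑⁻ → {B I : Subset n} → B ∈ᴸ 𝓑⁺ → Closed Σ' B → I ∈ᴸ 𝓑⁻ → ¬ I ⊆ B
dual⇒member⁺-contains-no-member⁻ Σ' dual {B} {I} B∈ B-closed I∈ I⊆B
  with dual B B-closed
... | inj₁ (_ , contains-no-member⁻) = contains-no-member⁻ (I , I∈ , I⊆B)
... | inj₂ (in-no-member⁺ , _)       = in-no-member⁺ (B , B∈ , ⊆-refl)

covering-member⁻⇒transversal-complements :
  (Σ' : Base n) {𝓑⁺ 𝓑⁻ : Family n} → Antichain Σ' 𝓑⁺ → Dual Σ' 𝓑⁺ 𝓑⁻ →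
  {I T : Subset n} → I ∈ᴸ 𝓑⁻ → CoveringSet Σ' I T →
  Transversal (complements 𝓑⁺) T
covering-member⁻⇒transversal-complements Σ' (closed⁺ , _) dual {T = T} I∈ cov E∈
  with ∈-map⁻ ∁ E∈
... | B , B∈ , refl with any? (λ y → (y ∈? T) ×-dec (y ∈? ∁ B))
...   | yes meets = meets
...   | no misses = ⊥-elim $
  dual⇒member⁺-contains-no-member⁻ Σ' dual B∈ B-closed I∈
    (covering⇒⊆-closed Σ' cov B-closed (misses-∁⇒⊆ misses))
  where
  B-closed : Closed Σ' B
  B-closed = lookup closed⁺ B∈

lemma4 : ∀ {n : ℕ} (Σ' : Base n) (𝓑⁺ 𝓑⁻ : Family n) →
    Antichain Σ' 𝓑⁺ → Antichain Σ' 𝓑⁻ → Dual Σ' 𝓑⁺ 𝓑⁻ →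
    (I T : Subset n) → I ∈ᴸ 𝓑⁻ →
    MinimalTransversal (complements 𝓑⁺) T → CoveringSet Σ' I T →
    MinimalCoveringSet Σ' I T
lemma4 Σ' 𝓑⁺ 𝓑⁻ antichain⁺ _ dual I T I∈ (_ , minimal) cov =
  cov , λ {x} x∈T cov-x →
    minimal (T - x) (x∈p⇒p-x⊂p x∈T)
      (covering-member⁻⇒transversal-complements Σ' antichain⁺ dual I∈ cov-x)
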